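{- Let a BTTP weight function $w$ on leagues $X,Y$ be given, let $X_\varepsilon\subseteq X$, $Y_\varepsilon\subseteq Y$ with $|X_\varepsilon|=|Y_\varepsilon|=n_\varepsilon$, $n_\varepsilon$ a positive multiple of 3, and let $\mathcal{C}_{X_\varepsilon}$ be a minimum weight cycle packing of the complete graph on $X_\varepsilon$. Construct a set $\mathcal{C}$ of cycles as follows: put every 3-cycle of $\mathcal{C}_{X_\varepsilon}$ into $\mathcal{C}$; for every cycle $C_q\in\mathcal{C}_{X_\varepsilon}$ with $q\ge 4$ vertices, delete from $C_q$ an edge $xx'$ minimizing $\delta_{Y_\varepsilon}(x)+\delta_{Y_\varepsilon}(x')-n_\varepsilon w(x,x')$ to obtain a path; then join all these paths (if any) into a single cycle in an arbitrary way by adding edges connecting terminals of consecutive paths, and put this cycle into $\mathcal{C}$. Then $\mathcal{C}$ is a cycle packing of the complete graph on $X_\varepsilon$ and \[n_\varepsilon w(\mathcal{C})\le \tfrac12\delta_{Y_\varepsilon}(X_\varepsilon)+\tfrac34 n_\varepsilon w(\mathcal{C}_{X_\varepsilon}).\]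
   Context: $w$ is a non-negative symmetric weight function on pairs of elements of $X\cup Y$ satisfying the triangle inequality. $\delta_{Y'}(x)=\sum_{y\in Y'}w(x,y)$ and $\delta_{Y'}(X')=\sum_{x\in X'}\delta_{Y'}(x)$. A cycle packing of a complete graph is a set of vertex-disjoint simple cycles, each on at least 3 vertices, covering all vertices; $w$ of a set of cycles is the total weight of their edges.
   Formalization: The weight function w takes rational values. -}

module Defs where

open import Data.Nat as ℕ using (ℕ; suc)
open import Data.Integer using (+_)
open import Data.Rational using (ℚ; 0ℚ; _+_; _*_; _-_; _≤_; _/_)
open import Data.List using (List; []; _∷_; _++_; _∷ʳ_; zip; map; foldr; concat; length; reverse)
open import Data.List.Membership.Propositional using (_∈_)
open import Data.List.Relation.Unary.All using (All)
open import Data.List.Relation.Unary.Unique.Propositional using (Unique)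
open import Data.List.Relation.Binary.Permutation.Propositional using (_↭_)
open import Data.List.Relation.Binary.Pointwise using (Pointwise)
open import Data.Product using (_×_; _,_; proj₁; proj₂; ∃; ∃-syntax)
open import Data.Sum using (_⊎_)
open import Relation.Binary.PropositionalEquality using (_≡_; _≢_)

ℕtoℚ : ℕ → ℚ
ℕtoℚ n = + n / 1

sumℚ : List ℚ → ℚ
sumℚ = foldr _+_ 0ℚ

module _ {V : Set} where

  record BTTPWeight (X Y : List V) (w : V → V → ℚ) : Set where
    field
      leagues-distinct : Unique (X ++ Y)
      leagues-size     : length X ≡ length Y
      nonneg    : ∀ {u v} → u ∈ X ++ Y → v ∈ X ++ Y → u ≢ v → 0ℚ ≤ w u v
      symmetric : ∀ {u v} → u ∈ X ++ Y → v ∈ X ++ Y → u ≢ v → w u v ≡ w v u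
      triangle  : ∀ {u v z} → u ∈ X ++ Y → v ∈ X ++ Y → z ∈ X ++ Y →
                  u ≢ v → v ≢ z → u ≢ z → w u z ≤ w u v + w v z

  δ : (V → V → ℚ) → List V → V → ℚ
  δ w ys x = sumℚ (map (w x) ys)

  δset : (V → V → ℚ) → List V → List V → ℚ
  δset w ys xs = sumℚ (map (δ w ys) xs)

  -- a cycle is given by its cyclic vertex sequence v0 … v(k-1);
  -- its edges are v_i v_{i+1} and the closing edge v(k-1) v0
  cycleEdges : List V → List (V × V)
  cycleEdges []       = []
  cycleEdges (v ∷ vs) = zip (v ∷ vs) (vs ∷ʳ v)

  cycleW : (V → V → ℚ) → List V → ℚ
  cycleW w c = sumℚ (map (λ e → w (proj₁ e) (proj₂ e)) (cycleEdges c))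

  W : (V → V → ℚ) → List (List V) → ℚ
  W w cs = sumℚ (map (cycleW w) cs)

  CyclePacking : List V → List (List V) → Set
  CyclePacking xs cs = All (λ c → 3 ℕ.≤ length c) cs × concat cs ↭ xs

  MinCyclePacking : (V → V → ℚ) → List V → List (List V) → Set
  MinCyclePacking w xs cs =
    CyclePacking xs cs × (∀ ds → CyclePacking xs ds → W w cs ≤ W w ds)

  cost : (V → V → ℚ) → List V → ℕ → V → V → ℚ
  cost w ys n x x' = δ w ys x + δ w ys x' - ℕtoℚ n * w x x'

  -- p is the path obtained from cycle c by deleting an edge x x' of c
  -- (x = last vertex of p, x' = first vertex of p) minimizing cost
  CutMin : (V → V → ℚ) → List V → ℕ → List V → List V → Set
  CutMin w ys n c p =
    ∃[ a ] ∃[ b ] ∃[ x ] ∃[ x' ] ∃[ m ]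
      (c ≡ a ++ b) × (p ≡ b ++ a) × (p ≡ x' ∷ (m ∷ʳ x)) ×
      (∀ {u v} → (u , v) ∈ cycleEdges c → cost w ys n x x' ≤ cost w ys n u v)

  data Split (w : V → V → ℚ) (ys : List V) (n : ℕ) :
             List (List V) → List (List V) → List (List V) → Set where
    []  : Split w ys n [] [] []
    tri : ∀ {c cs ts ps} → length c ≡ 3 →
          Split w ys n cs ts ps → Split w ys n (c ∷ cs) (c ∷ ts) ps
    big : ∀ {c p cs ts ps} → 4 ℕ.≤ length c → CutMin w ys n c p →
          Split w ys n cs ts ps → Split w ys n (c ∷ cs) ts (p ∷ ps)

  joinAll : List (List V) → List (List V)
  joinAll []         = []
  joinAll (q ∷ qs)   = concat (q ∷ qs) ∷ []

  -- C is obtained from CX by the construction: keep 3-cycles; cut every larger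
  -- cycle into a path; join all paths in an arbitrary order and orientation
  Constructed : (V → V → ℚ) → List V → ℕ → List (List V) → List (List V) → Set
  Constructed w ys n CX C =
    ∃[ ts ] ∃[ ps ] ∃[ ps' ] ∃[ qs ]
      Split w ys n CX ts ps ×
      Pointwise (λ p p' → p' ≡ p ⊎ p' ≡ reverse p) ps ps' ×
      ps' ↭ qs ×
      C ≡ ts ++ joinAll qs

-- Write n for n_ε and δ for δ_{Y_ε}. Summing the triangle inequality through every y ∈ Y_ε gives
-- n·w(u,v) ≤ δ(u) + δ(v) for distinct u, v ∈ X, so every edge uv has a nonnegative cost
-- δ(u) + δ(v) − n·w(u,v), and the costs around a cycle C add up to 2δ(C) − n·w(C).
-- Hence a 3-cycle has n·w(C) ≤ 2δ(C), while on a cycle with q ≥ 4 vertices the cheapest edge xx'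
-- has cost K ≤ (2δ(C) − n·w(C))/4, and the path left after deleting it has "charge"
-- n·w(path) + δ(x) + δ(x') = n·w(C) + K. A joining edge yz has n·w(y,z) ≤ δ(y) + δ(z), which is
-- paid for by the endpoint terms of the charges, so n times the weight of the joined cycle is at most
-- the total charge of the paths. Each cycle C of the packing therefore contributes at most
-- ½δ(C) + ¾n·w(C).
module Submission where

open import Defs
open import Data.Nat as ℕ using (ℕ; zero; suc; z≤n; s≤s; _*_)
import Data.Nat.Properties as ℕ
import Data.Nat.Coprimality as Coprime
open import Data.Integer as ℤ using (+_)
import Data.Integer.Properties as ℤ
open import Data.Rational using (ℚ; 0ℚ; 1ℚ; ½; _+_; _-_; -_; _≤_; _/_; mkℚ)
  renaming (_*_ to _*ℚ_)
open import Data.Rational.Properties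
open import Data.Rational.Solver using (module +-*-Solver)
open import Data.List
  using (List; []; _∷_; _++_; _∷ʳ_; zip; map; concat; length; reverse; initLast; _∷ʳ′_)
import Data.List.Properties as List
open import Data.List.Membership.Propositional using (_∈_)
open import Data.List.Membership.Propositional.Properties using (∈-++⁺ˡ; ∈-++⁺ʳ)
open import Data.List.Relation.Unary.Any using (here; there)
open import Data.List.Relation.Unary.All as All using (All; []; _∷_)
import Data.List.Relation.Unary.All.Properties as All
open import Data.List.Relation.Unary.AllPairs using (AllPairs; []; _∷_)
open import Data.List.Relation.Unary.Linked using (Linked; []; [-]; _∷_)
open import Data.List.Relation.Unary.Linked.Properties using (AllPairs⇒Linked)
open import Data.List.Relation.Unary.Unique.Propositional using (Unique)
open import Data.List.Relation.Binary.Subset.Propositional using (_⊆_)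
import Data.List.Relation.Binary.Permutation.Propositional as ↭
open import Data.List.Relation.Binary.Permutation.Propositional
  using (_↭_; ↭-refl; ↭-sym; ↭-trans; ↭-reflexive; ↭⇒↭ₛ; module PermutationReasoning)
open import Data.List.Relation.Binary.Permutation.Propositional.Properties
  using (++⁺; ++⁺ˡ; shifts; ∷↭∷ʳ; ↭-length; ↭-reverse; ++-comm; map⁺; All-resp-↭)
open import Data.List.Relation.Binary.Permutation.Setoid.Properties
  using (foldr-commMonoid; AllPairs-resp-↭)
open import Data.List.Relation.Binary.Pointwise using (Pointwise; []; _∷_; All-resp-Pointwise)
open import Data.Product using (_×_; _,_; proj₁; proj₂; uncurry; ∃-syntax)
open import Data.Sum using (_⊎_; inj₁; inj₂)
open import Function using (_∘_)
open import Relation.Binary.PropositionalEquality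
  using (_≡_; _≢_; refl; sym; trans; cong; cong₂; subst; setoid; resp₂; module ≡-Reasoning)

ℕtoℚ-suc : ∀ m → ℕtoℚ (suc m) ≡ 1ℚ + ℕtoℚ m
ℕtoℚ-suc m = begin
  ℕtoℚ (suc m)         ≡⟨ cong (λ i → (+ 1 ℤ.+ i) / 1) (sym (ℤ.*-identityʳ (+ m))) ⟩
  1ℚ + mkℚ (+ m) 0 m⊥1 ≡⟨ cong (λ q → 1ℚ + q) (sym (normalize-coprime {m} {0} m⊥1)) ⟩
  1ℚ + ℕtoℚ m          ∎
  where
  open ≡-Reasoning
  m⊥1 = Coprime.sym (Coprime.1-coprimeTo m)

p≤q⇒0≤q-p : ∀ {p q} → p ≤ q → 0ℚ ≤ q - p
p≤q⇒0≤q-p {p} {q} p≤q = begin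
  0ℚ    ≡⟨ +-inverseʳ p ⟨
  p - p ≤⟨ +-monoˡ-≤ (- p) p≤q ⟩
  q - p ∎
  where open ≤-Reasoning

budget-≤ : ∀ X K d → X + ℕtoℚ 4 *ℚ K ≤ d + d → X + K ≤ ½ *ℚ d + (+ 3 / 4) *ℚ X
budget-≤ X K d h = begin
  X + K
    ≡⟨ solve 2 (λ X K → X :+ K := con ¾ :* X :+ con ¼ :* (X :+ con (ℕtoℚ 4) :* K)) refl X K ⟩
  ¾ *ℚ X + ¼ *ℚ (X + ℕtoℚ 4 *ℚ K)
    ≤⟨ +-monoʳ-≤ (¾ *ℚ X) (*-monoˡ-≤-nonNeg ¼ h) ⟩
  ¾ *ℚ X + ¼ *ℚ (d + d)
    ≡⟨ solve 2 (λ X d → con ¾ :* X :+ con ¼ :* (d :+ d) := con ½ :* d :+ con ¾ :* X) refl X d ⟩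
  ½ *ℚ d + ¾ *ℚ X
    ∎
  where
  open ≤-Reasoning
  open +-*-Solver
  ¼ ¾ : ℚ
  ¼ = + 1 / 4
  ¾ = + 3 / 4

∑ : {A : Set} → (A → ℚ) → List A → ℚ
∑ f xs = sumℚ (map f xs)

module _ {A : Set} (f : A → ℚ) where

  ∑-++ : ∀ xs ys → ∑ f (xs ++ ys) ≡ ∑ f xs + ∑ f ys
  ∑-++ []       ys = sym (+-identityˡ (∑ f ys))
  ∑-++ (x ∷ xs) ys = trans (cong (_+_ (f x)) (∑-++ xs ys)) (sym (+-assoc (f x) (∑ f xs) (∑ f ys)))

  ∑-↭ : ∀ {xs ys} → xs ↭ ys → ∑ f xs ≡ ∑ f ys
  ∑-↭ p = foldr-commMonoid (setoid ℚ) +-0-isCommutativeMonoid (↭⇒↭ₛ (map⁺ f p))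

  ∑-+ : ∀ (g : A → ℚ) xs → ∑ (λ x → f x + g x) xs ≡ ∑ f xs + ∑ g xs
  ∑-+ g []       = refl
  ∑-+ g (x ∷ xs) = trans (cong (_+_ (f x + g x)) (∑-+ g xs))
    (solve 4 (λ a b c d → (a :+ b) :+ (c :+ d) := (a :+ c) :+ (b :+ d)) refl (f x) (g x) (∑ f xs) (∑ g xs))
    where open +-*-Solver

  ∑-nonneg : ∀ {xs} → All (λ x → 0ℚ ≤ f x) xs → 0ℚ ≤ ∑ f xs
  ∑-nonneg []         = ≤-refl
  ∑-nonneg (0≤fx ∷ h) = +-mono-≤ 0≤fx (∑-nonneg h)

  ∑-≥ : ∀ {K} m {xs} → 0ℚ ≤ K → m ℕ.≤ length xs → (∀ {x} → x ∈ xs → K ≤ f x) →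
        ℕtoℚ m *ℚ K ≤ ∑ f xs
  ∑-≥ {K} zero {xs} 0≤K _ K≤f = begin
    0ℚ *ℚ K ≡⟨ *-zeroˡ K ⟩
    0ℚ      ≤⟨ ∑-nonneg (All.tabulate (λ x∈ → ≤-trans 0≤K (K≤f x∈))) ⟩
    ∑ f xs  ∎
    where open ≤-Reasoning
  ∑-≥ {K} (suc m) {x ∷ xs} 0≤K (s≤s m≤) K≤f = begin
    ℕtoℚ (suc m) *ℚ K     ≡⟨ cong (_*ℚ K) (ℕtoℚ-suc m) ⟩
    (1ℚ + ℕtoℚ m) *ℚ K    ≡⟨ *-distribʳ-+ K 1ℚ (ℕtoℚ m) ⟩
    1ℚ *ℚ K + ℕtoℚ m *ℚ K ≡⟨ cong (_+ ℕtoℚ m *ℚ K) (*-identityˡ K) ⟩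
    K + ℕtoℚ m *ℚ K       ≤⟨ +-mono-≤ (K≤f (here refl)) (∑-≥ m 0≤K m≤ (K≤f ∘ there)) ⟩
    f x + ∑ f xs          ∎
    where open ≤-Reasoning

module _ {A : Set} where

  Unique-++⇒Disjoint : ∀ xs {ys : List A} {x y} → Unique (xs ++ ys) → x ∈ xs → y ∈ ys → x ≢ y
  Unique-++⇒Disjoint (x ∷ xs) (x∉ ∷ _) (here refl) y∈ys = All.lookup x∉ (∈-++⁺ʳ xs y∈ys)
  Unique-++⇒Disjoint (_ ∷ xs) (_ ∷ u)  (there x∈) y∈ys = Unique-++⇒Disjoint xs u x∈ y∈ys

  AllPairs-++⁻ : ∀ {R : A → A → Set} xs {ys} → AllPairs R (xs ++ ys) → AllPairs R xs × AllPairs R ys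
  AllPairs-++⁻ []       rs       = [] , rs
  AllPairs-++⁻ (x ∷ xs) (r ∷ rs) with AllPairs-++⁻ xs rs
  ... | rxs , rys = All.++⁻ˡ xs r ∷ rxs , rys

  AllPairs-concat⁻ : ∀ {R : A → A → Set} xss → AllPairs R (concat xss) → All (AllPairs R) xss
  AllPairs-concat⁻ []         _  = []
  AllPairs-concat⁻ (xs ∷ xss) rs with AllPairs-++⁻ xs rs
  ... | rxs , rxss = rxs ∷ AllPairs-concat⁻ xss rxss

  concat-↭ : ∀ {xss yss : List (List A)} → xss ↭ yss → concat xss ↭ concat yss
  concat-↭ ↭.refl           = ↭-refl
  concat-↭ (↭.prep xs p)    = ++⁺ˡ xs (concat-↭ p)
  concat-↭ (↭.swap xs ys p) = ↭-trans (++⁺ˡ xs (++⁺ˡ ys (concat-↭ p))) (shifts xs ys)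
  concat-↭ (↭.trans p q)    = ↭-trans (concat-↭ p) (concat-↭ q)

  Reoriented : List A → List A → Set
  Reoriented p p' = p' ≡ p ⊎ p' ≡ reverse p

  reoriented-↭ : ∀ {p p'} → Reoriented p p' → p' ↭ p
  reoriented-↭ (inj₁ refl) = ↭-refl
  reoriented-↭ (inj₂ refl) = ↭-reverse _

  concat-reoriented : ∀ {ps ps'} → Pointwise Reoriented ps ps' → concat ps' ↭ concat ps
  concat-reoriented []       = ↭-refl
  concat-reoriented (r ∷ rs) = ++⁺ (reoriented-↭ r) (concat-reoriented rs)

  reoriented-length : ∀ {k ps ps'} → Pointwise Reoriented ps ps' →
                      All (λ p → k ℕ.≤ length p) ps → All (λ p → k ℕ.≤ length p) ps'
  reoriented-length {k} = All-resp-Pointwise (λ r → subst (k ℕ.≤_) (sym (↭-length (reoriented-↭ r))))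

  joinAll-length : ∀ (qs : List (List A)) →
                   All (λ q → 4 ℕ.≤ length q) qs → All (λ c → 3 ℕ.≤ length c) (joinAll qs)
  joinAll-length []       _        = []
  joinAll-length (q ∷ qs) (4≤ ∷ _) =
    ℕ.≤-trans (ℕ.n≤1+n 3) (ℕ.≤-trans 4≤ (List.length-++-≤ˡ q)) ∷ []

  concat-joinAll : ∀ (qs : List (List A)) → concat (joinAll qs) ≡ concat qs
  concat-joinAll []       = refl
  concat-joinAll (q ∷ qs) = List.++-identityʳ (concat (q ∷ qs))

pathEdges : {V : Set} → List V → List (V × V)
pathEdges (u ∷ v ∷ l) = (u , v) ∷ pathEdges (v ∷ l)
pathEdges _           = []

module _ {V : Set} where

  zip-∷ʳ : ∀ (u : V) l z → zip (u ∷ l) (l ∷ʳ z) ≡ pathEdges (u ∷ l ∷ʳ z)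
  zip-∷ʳ u []      z = refl
  zip-∷ʳ u (v ∷ l) z = cong ((u , v) ∷_) (zip-∷ʳ v l z)

  pathEdges-∷ʳ : ∀ (p : List V) y z → pathEdges (p ∷ʳ y ∷ʳ z) ≡ pathEdges (p ∷ʳ y) ∷ʳ (y , z)
  pathEdges-∷ʳ []          y z = refl
  pathEdges-∷ʳ (a ∷ [])    y z = refl
  pathEdges-∷ʳ (a ∷ b ∷ p) y z = cong ((a , b) ∷_) (pathEdges-∷ʳ (b ∷ p) y z)

  pathEdges-reverse : ∀ (u v : V) l →
                      pathEdges (reverse (u ∷ v ∷ l)) ≡ pathEdges (reverse (v ∷ l)) ∷ʳ (v , u)
  pathEdges-reverse u v l = begin
    pathEdges (reverse (u ∷ v ∷ l))
      ≡⟨ cong pathEdges (List.unfold-reverse u (v ∷ l)) ⟩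
    pathEdges (reverse (v ∷ l) ∷ʳ u)
      ≡⟨ cong (λ p → pathEdges (p ∷ʳ u)) (List.unfold-reverse v l) ⟩
    pathEdges (reverse l ∷ʳ v ∷ʳ u)
      ≡⟨ pathEdges-∷ʳ (reverse l) v u ⟩
    pathEdges (reverse l ∷ʳ v) ∷ʳ (v , u)
      ≡⟨ cong (λ p → pathEdges p ∷ʳ (v , u)) (List.unfold-reverse v l) ⟨
    pathEdges (reverse (v ∷ l)) ∷ʳ (v , u)
      ∎
    where open ≡-Reasoning

  cycleEdges-cut : ∀ (u : V) m z → cycleEdges (u ∷ m ∷ʳ z) ≡ pathEdges (u ∷ m ∷ʳ z) ∷ʳ (z , u)
  cycleEdges-cut u m z = trans (zip-∷ʳ u (m ∷ʳ z) u) (pathEdges-∷ʳ (u ∷ m) z u)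

  cycleEdges-rotate : ∀ (a b : List V) → cycleEdges (a ++ b) ↭ cycleEdges (b ++ a)
  cycleEdges-rotate []      b = ↭-reflexive (cong cycleEdges (sym (List.++-identityʳ b)))
  cycleEdges-rotate (u ∷ a) b = begin
    cycleEdges (u ∷ a ++ b)    ↭⟨ rotate₁ u (a ++ b) ⟩
    cycleEdges ((a ++ b) ∷ʳ u) ≡⟨ cong cycleEdges (List.++-assoc a b (u ∷ [])) ⟩
    cycleEdges (a ++ b ∷ʳ u)   ↭⟨ cycleEdges-rotate a (b ∷ʳ u) ⟩
    cycleEdges (b ∷ʳ u ++ a)   ≡⟨ cong cycleEdges (List.++-assoc b (u ∷ []) a) ⟩
    cycleEdges (b ++ u ∷ a)    ∎
    where
    open PermutationReasoning
    rotate₁ : ∀ u l → cycleEdges (u ∷ l) ↭ cycleEdges (l ∷ʳ u)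
    rotate₁ u []      = ↭-refl
    rotate₁ u (v ∷ l) = begin
      cycleEdges (u ∷ v ∷ l)            ≡⟨ zip-∷ʳ u (v ∷ l) u ⟩
      (u , v) ∷ pathEdges (v ∷ l ∷ʳ u)  ↭⟨ ∷↭∷ʳ (u , v) (pathEdges (v ∷ l ∷ʳ u)) ⟩
      pathEdges (v ∷ l ∷ʳ u) ∷ʳ (u , v) ≡⟨ cycleEdges-cut v l u ⟨
      cycleEdges (v ∷ l ∷ʳ u)           ∎

  length-cycleEdges : ∀ (c : List V) → length (cycleEdges c) ≡ length c
  length-cycleEdges []      = refl
  length-cycleEdges (u ∷ l) = begin
    length (cycleEdges (u ∷ l))     ≡⟨ cong length (zip-∷ʳ u l u) ⟩
    length (pathEdges (u ∷ l ∷ʳ u)) ≡⟨ length-pathEdges u (l ∷ʳ u) ⟩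
    length (l ∷ʳ u)                 ≡⟨ ↭-length (∷↭∷ʳ u l) ⟨
    length (u ∷ l)                  ∎
    where
    open ≡-Reasoning
    length-pathEdges : ∀ u p → length (pathEdges (u ∷ p)) ≡ length p
    length-pathEdges u []      = refl
    length-pathEdges u (v ∷ p) = cong suc (length-pathEdges v p)

  Linked⇒All-pathEdges : ∀ {R : V → V → Set} {p} → Linked R p → All (uncurry R) (pathEdges p)
  Linked⇒All-pathEdges []       = []
  Linked⇒All-pathEdges [-]      = []
  Linked⇒All-pathEdges (r ∷ rs) = r ∷ Linked⇒All-pathEdges rs

module Construction {V : Set} (w : V → V → ℚ) (ys : List V) (n : ℕ)
  (_#_ : V → V → Set) (#-sym : ∀ {u v} → u # v → v # u)
  (w-sym : ∀ {u v} → u # v → w u v ≡ w v u)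
  (w-bound : ∀ {u v} → u # v → ℕtoℚ n *ℚ w u v ≤ δ w ys u + δ w ys v) where

  private
    N : ℚ
    N = ℕtoℚ n

    κ : V → V → ℚ
    κ = cost w ys n

  Simple : List V → Set
  Simple = AllPairs _#_

  Simple-↭ : ∀ {c c'} → c ↭ c' → Simple c → Simple c'
  Simple-↭ c↭c' = AllPairs-resp-↭ (setoid V) #-sym (resp₂ _#_) (↭⇒↭ₛ c↭c')

  Simple⇒ends# : ∀ {u} m {z} → Simple (u ∷ m ∷ʳ z) → z # u
  Simple⇒ends# m (u#rest ∷ _) = #-sym (All.lookup u#rest (∈-++⁺ʳ m (here refl)))

  cost-nonneg : ∀ {u v} → u # v → 0ℚ ≤ κ u v
  cost-nonneg u#v = p≤q⇒0≤q-p (w-bound u#v)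

  cost-sym : ∀ {u v} → u # v → κ u v ≡ κ v u
  cost-sym {u} {v} u#v = cong₂ _-_ (+-comm (δ w ys u) (δ w ys v)) (cong (N *ℚ_) (w-sym u#v))

  pathCost : List V → ℚ
  pathCost p = ∑ (uncurry κ) (pathEdges p)

  twiceδ : List V → ℚ
  twiceδ p = δset w ys p + δset w ys p

  -- By charge-cut, the charge of a path x' ∷ m ∷ʳ x is n·w(path) + δ(x') + δ(x).
  charge : List V → ℚ
  charge p = twiceδ p - pathCost p

  budget : List V → ℚ
  budget c = ½ *ℚ δset w ys c + (+ 3 / 4) *ℚ (N *ℚ cycleW w c)

  ∑-cost-zip : ∀ xs zs → length xs ≡ length zs →
               ∑ (uncurry κ) (zip xs zs) ≡ δset w ys xs + δset w ys zs - N *ℚ ∑ (uncurry w) (zip xs zs)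
  ∑-cost-zip []       []       _  = solve 1 (λ N → con 0ℚ := con 0ℚ :+ con 0ℚ :- N :* con 0ℚ) refl N
    where open +-*-Solver
  ∑-cost-zip (x ∷ xs) (z ∷ zs) eq rewrite ∑-cost-zip xs zs (ℕ.suc-injective eq) =
    solve 7 (λ N dx dz wxz Dx Dz W →
               (dx :+ dz :- N :* wxz) :+ (Dx :+ Dz :- N :* W) := (dx :+ Dx) :+ (dz :+ Dz) :- N :* (wxz :+ W))
      refl N (δ w ys x) (δ w ys z) (w x z) (δset w ys xs) (δset w ys zs) (∑ (uncurry w) (zip xs zs))
    where open +-*-Solver

  ∑-cost-cycle : ∀ c → ∑ (uncurry κ) (cycleEdges c) ≡ twiceδ c - N *ℚ cycleW w c
  ∑-cost-cycle []      = solve 1 (λ N → con 0ℚ := con 0ℚ :+ con 0ℚ :- N :* con 0ℚ) refl N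
    where open +-*-Solver
  ∑-cost-cycle (u ∷ l) = trans (∑-cost-zip (u ∷ l) (l ∷ʳ u) (↭-length (∷↭∷ʳ u l)))
    (cong (λ d → δset w ys (u ∷ l) + d - N *ℚ cycleW w (u ∷ l)) (∑-↭ (δ w ys) (↭-sym (∷↭∷ʳ u l))))

  charge-cut : ∀ u m z → charge (u ∷ m ∷ʳ z) ≡ N *ℚ cycleW w (u ∷ m ∷ʳ z) + κ z u
  charge-cut u m z = begin
    D - P
      ≡⟨ solve 3 (λ D P X → D :- P := (D :- X) :+ X :- P) refl D P X ⟩
    (D - X) + X - P
      ≡⟨ cong (λ t → t + X - P) closing ⟩
    (P + (κ z u + 0ℚ)) + X - P
      ≡⟨ solve 3 (λ P K X → (P :+ (K :+ con 0ℚ)) :+ X :- P := X :+ K) refl P (κ z u) X ⟩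
    X + κ z u
      ∎
    where
    open ≡-Reasoning
    open +-*-Solver
    c = u ∷ m ∷ʳ z
    D = twiceδ c
    P = pathCost c
    X = N *ℚ cycleW w c
    closing : D - X ≡ P + (κ z u + 0ℚ)
    closing = begin
      D - X                                         ≡⟨ ∑-cost-cycle c ⟨
      ∑ (uncurry κ) (cycleEdges c)                  ≡⟨ cong (∑ (uncurry κ)) (cycleEdges-cut u m z) ⟩
      ∑ (uncurry κ) (pathEdges c ∷ʳ (z , u))        ≡⟨ ∑-++ (uncurry κ) (pathEdges c) ((z , u) ∷ []) ⟩
      P + (κ z u + 0ℚ)                              ∎

  pathCost-++ : ∀ p q → Linked _#_ (p ++ q) → pathCost p + pathCost q ≤ pathCost (p ++ q)
  pathCost-++ []          q       _          = ≤-reflexive (+-identityˡ (pathCost q))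
  pathCost-++ (u ∷ [])    []      _          = ≤-refl
  pathCost-++ (u ∷ [])    (v ∷ q) (u#v ∷ _)  = +-monoˡ-≤ (pathCost (v ∷ q)) (cost-nonneg u#v)
  pathCost-++ (u ∷ v ∷ p) q       (u#v ∷ ls) = begin
    κ u v + pathCost (v ∷ p) + pathCost q   ≡⟨ +-assoc (κ u v) _ _ ⟩
    κ u v + (pathCost (v ∷ p) + pathCost q) ≤⟨ +-monoʳ-≤ (κ u v) (pathCost-++ (v ∷ p) q ls) ⟩
    κ u v + pathCost (v ∷ p ++ q)           ∎
    where open ≤-Reasoning

  pathCost-reverse : ∀ {p} → Linked _#_ p → pathCost (reverse p) ≡ pathCost p
  pathCost-reverse []                     = refl
  pathCost-reverse [-]                    = refl
  pathCost-reverse {u ∷ v ∷ l} (u#v ∷ ls) = begin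
    pathCost (reverse (u ∷ v ∷ l))
      ≡⟨ cong (∑ (uncurry κ)) (pathEdges-reverse u v l) ⟩
    ∑ (uncurry κ) (pathEdges (reverse (v ∷ l)) ∷ʳ (v , u))
      ≡⟨ ∑-++ (uncurry κ) (pathEdges (reverse (v ∷ l))) ((v , u) ∷ []) ⟩
    pathCost (reverse (v ∷ l)) + (κ v u + 0ℚ)
      ≡⟨ cong₂ _+_ (pathCost-reverse ls) (trans (+-identityʳ (κ v u)) (cost-sym (#-sym u#v))) ⟩
    pathCost (v ∷ l) + κ u v
      ≡⟨ +-comm (pathCost (v ∷ l)) (κ u v) ⟩
    pathCost (u ∷ v ∷ l)
      ∎
    where open ≡-Reasoning

  charge-++ : ∀ p q → Linked _#_ (p ++ q) → charge (p ++ q) ≤ charge p + charge q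
  charge-++ p q ls = begin
    twiceδ (p ++ q) - pathCost (p ++ q)
      ≤⟨ +-monoʳ-≤ (twiceδ (p ++ q)) (neg-antimono-≤ (pathCost-++ p q ls)) ⟩
    twiceδ (p ++ q) - (Pp + Pq)
      ≡⟨ cong (λ d → d + d - (Pp + Pq)) (∑-++ (δ w ys) p q) ⟩
    (Dp + Dq) + (Dp + Dq) - (Pp + Pq)
      ≡⟨ solve 4 (λ a b c d → (a :+ b) :+ (a :+ b) :- (c :+ d) := (a :+ a :- c) :+ (b :+ b :- d))
                 refl Dp Dq Pp Pq ⟩
    charge p + charge q
      ∎
    where
    open ≤-Reasoning
    open +-*-Solver
    Dp = δset w ys p
    Dq = δset w ys q
    Pp = pathCost p
    Pq = pathCost q

  charge-concat : ∀ qs → Simple (concat qs) → charge (concat qs) ≤ ∑ charge qs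
  charge-concat []       _ = ≤-refl
  charge-concat (q ∷ qs) s = ≤-trans (charge-++ q (concat qs) (AllPairs⇒Linked s))
    (+-monoʳ-≤ (charge q) (charge-concat qs (proj₂ (AllPairs-++⁻ q s))))

  charge-reverse : ∀ {p} → Linked _#_ p → charge (reverse p) ≡ charge p
  charge-reverse {p} ls = cong₂ (λ d c → d + d - c) (∑-↭ (δ w ys) (↭-reverse p)) (pathCost-reverse ls)

  charge≤twiceδ : ∀ {p} → Linked _#_ p → charge p ≤ twiceδ p
  charge≤twiceδ {p} ls = begin
    twiceδ p - pathCost p ≤⟨ +-monoʳ-≤ (twiceδ p) (neg-antimono-≤ 0≤pathCost) ⟩
    twiceδ p - 0ℚ         ≡⟨ +-identityʳ (twiceδ p) ⟩
    twiceδ p              ∎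
    where
    open ≤-Reasoning
    0≤pathCost = ∑-nonneg (uncurry κ) (All.map cost-nonneg (Linked⇒All-pathEdges ls))

  cycleW≤charge : ∀ {c} → Simple c → 2 ℕ.≤ length c → N *ℚ cycleW w c ≤ charge c
  cycleW≤charge {u ∷ l} s 2≤ with initLast l
  cycleW≤charge {u ∷ .[]}       s (s≤s ()) | []
  cycleW≤charge {u ∷ .(m ∷ʳ z)} s _        | m ∷ʳ′ z = begin
    N *ℚ cycleW w c           ≡⟨ +-identityʳ _ ⟨
    N *ℚ cycleW w c + 0ℚ      ≤⟨ +-monoʳ-≤ (N *ℚ cycleW w c) (cost-nonneg (Simple⇒ends# m s)) ⟩
    N *ℚ cycleW w c + κ z u   ≡⟨ charge-cut u m z ⟨
    charge c                  ∎
    where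
    open ≤-Reasoning
    c = u ∷ m ∷ʳ z

  simpleCycle-bound : ∀ {c} → Simple c → 2 ℕ.≤ length c → N *ℚ cycleW w c ≤ budget c
  simpleCycle-bound {c} s 2≤ = begin
    X        ≡⟨ +-identityʳ X ⟨
    X + 0ℚ   ≤⟨ budget-≤ X 0ℚ (δset w ys c) X≤twiceδ ⟩
    budget c ∎
    where
    open ≤-Reasoning
    X = N *ℚ cycleW w c
    X≤twiceδ : X + ℕtoℚ 4 *ℚ 0ℚ ≤ twiceδ c
    X≤twiceδ = begin
      X + ℕtoℚ 4 *ℚ 0ℚ ≡⟨ +-identityʳ X ⟩
      X                ≤⟨ cycleW≤charge s 2≤ ⟩
      charge c         ≤⟨ charge≤twiceδ (AllPairs⇒Linked s) ⟩
      twiceδ c         ∎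

  cut-↭ : ∀ {c p} → CutMin w ys n c p → p ↭ c
  cut-↭ (a , b , _ , _ , _ , refl , refl , _) = ++-comm b a

  cut-bound : ∀ {c p} → Simple c → 4 ℕ.≤ length c → CutMin w ys n c p → charge p ≤ budget c
  cut-bound s 4≤ (a , b , x , x' , m , refl , refl , b++a≡ , minimal) = begin
    charge (b ++ a)                  ≡⟨ cong charge b++a≡ ⟩
    charge (x' ∷ m ∷ʳ x)             ≡⟨ charge-cut x' m x ⟩
    N *ℚ cycleW w (x' ∷ m ∷ʳ x) + K  ≡⟨ cong (λ p → N *ℚ cycleW w p + K) b++a≡ ⟨
    N *ℚ cycleW w (b ++ a) + K       ≡⟨ cong (λ t → N *ℚ t + K) (∑-↭ (uncurry w) (cycleEdges-rotate b a)) ⟩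
    X + K                            ≤⟨ budget-≤ X K (δset w ys (a ++ b)) X+4K≤twiceδ ⟩
    budget (a ++ b)                  ∎
    where
    open ≤-Reasoning
    K = κ x x'
    X = N *ℚ cycleW w (a ++ b)
    0≤K : 0ℚ ≤ K
    0≤K = cost-nonneg (Simple⇒ends# m (subst Simple b++a≡ (Simple-↭ (++-comm a b) s)))
    4≤edges : 4 ℕ.≤ length (cycleEdges (a ++ b))
    4≤edges = subst (4 ℕ.≤_) (sym (length-cycleEdges (a ++ b))) 4≤
    X+4K≤twiceδ : X + ℕtoℚ 4 *ℚ K ≤ twiceδ (a ++ b)
    X+4K≤twiceδ = begin
      X + ℕtoℚ 4 *ℚ K                         ≤⟨ +-monoʳ-≤ X (∑-≥ (uncurry κ) 4 0≤K 4≤edges minimal) ⟩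
      X + ∑ (uncurry κ) (cycleEdges (a ++ b)) ≡⟨ cong (_+_ X) (∑-cost-cycle (a ++ b)) ⟩
      X + (twiceδ (a ++ b) - X)               ≡⟨ solve 2 (λ X D → X :+ (D :- X) := D) refl X (twiceδ (a ++ b)) ⟩
      twiceδ (a ++ b)                         ∎
      where open +-*-Solver

  ∑-budget : ∀ cs → ∑ budget cs ≡ ½ *ℚ δset w ys (concat cs) + (+ 3 / 4) *ℚ (N *ℚ W w cs)
  ∑-budget []       = solve 1 (λ N → con 0ℚ := con ½ :* con 0ℚ :+ con (+ 3 / 4) :* (N :* con 0ℚ)) refl N
    where open +-*-Solver
  ∑-budget (c ∷ cs) = begin
    budget c + ∑ budget cs
      ≡⟨ cong (_+_ (budget c)) (∑-budget cs) ⟩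
    budget c + (½ *ℚ Dcs + (+ 3 / 4) *ℚ (N *ℚ W w cs))
      ≡⟨ solve 5 (λ N dc wc ds ws →
                    con ½ :* dc :+ ¾ :* (N :* wc) :+ (con ½ :* ds :+ ¾ :* (N :* ws))
                      := con ½ :* (dc :+ ds) :+ ¾ :* (N :* (wc :+ ws)))
                 refl N (δset w ys c) (cycleW w c) Dcs (W w cs) ⟩
    ½ *ℚ (δset w ys c + Dcs) + (+ 3 / 4) *ℚ (N *ℚ W w (c ∷ cs))
      ≡⟨ cong (λ d → ½ *ℚ d + (+ 3 / 4) *ℚ (N *ℚ W w (c ∷ cs))) (∑-++ (δ w ys) c (concat cs)) ⟨
    ½ *ℚ δset w ys (concat (c ∷ cs)) + (+ 3 / 4) *ℚ (N *ℚ W w (c ∷ cs))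
      ∎
    where
    open ≡-Reasoning
    open +-*-Solver
    Dcs = δset w ys (concat cs)
    ¾ = con (+ 3 / 4)

  split-↭ : ∀ {cs ts ps} → Split w ys n cs ts ps → concat ts ++ concat ps ↭ concat cs
  split-↭ []                                  = ↭-refl
  split-↭ (tri {c} {_} {ts} {ps} _ sp)        =
    ↭-trans (↭-reflexive (List.++-assoc c (concat ts) (concat ps))) (++⁺ˡ c (split-↭ sp))
  split-↭ (big {_} {p} {_} {ts} {_} _ cut sp) = ↭-trans (shifts (concat ts) p) (++⁺ (cut-↭ cut) (split-↭ sp))

  split-triangles : ∀ {cs ts ps} → Split w ys n cs ts ps → All (λ t → 3 ℕ.≤ length t) ts
  split-triangles []             = []
  split-triangles (tri |c|≡3 sp) = ℕ.≤-reflexive (sym |c|≡3) ∷ split-triangles sp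
  split-triangles (big _ _ sp)   = split-triangles sp

  split-paths : ∀ {cs ts ps} → Split w ys n cs ts ps → All (λ p → 4 ℕ.≤ length p) ps
  split-paths []              = []
  split-paths (tri _ sp)      = split-paths sp
  split-paths (big 4≤ cut sp) = subst (4 ℕ.≤_) (sym (↭-length (cut-↭ cut))) 4≤ ∷ split-paths sp

  split-bound : ∀ {cs ts ps} → Split w ys n cs ts ps → All Simple cs →
                N *ℚ W w ts + ∑ charge ps ≤ ∑ budget cs
  split-bound [] [] = ≤-reflexive (solve 1 (λ N → N :* con 0ℚ :+ con 0ℚ := con 0ℚ) refl N)
    where open +-*-Solver
  split-bound (tri {c} {cs} {ts} {ps} |c|≡3 sp) (s ∷ ss) = begin
    N *ℚ (cycleW w c + W w ts) + ∑ charge ps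
      ≡⟨ solve 4 (λ N a b c → N :* (a :+ b) :+ c := N :* a :+ (N :* b :+ c))
                 refl N (cycleW w c) (W w ts) (∑ charge ps) ⟩
    N *ℚ cycleW w c + (N *ℚ W w ts + ∑ charge ps)
      ≤⟨ +-mono-≤ (simpleCycle-bound s 2≤|c|) (split-bound sp ss) ⟩
    budget c + ∑ budget cs
      ∎
    where
    open ≤-Reasoning
    open +-*-Solver
    2≤|c| = subst (2 ℕ.≤_) (sym |c|≡3) (s≤s (s≤s z≤n))
  split-bound (big {c} {p} {cs} {ts} {ps} 4≤ cut sp) (s ∷ ss) = begin
    N *ℚ W w ts + (charge p + ∑ charge ps)
      ≡⟨ solve 3 (λ a b c → a :+ (b :+ c) := b :+ (a :+ c)) refl (N *ℚ W w ts) (charge p) (∑ charge ps) ⟩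
    charge p + (N *ℚ W w ts + ∑ charge ps)
      ≤⟨ +-mono-≤ (cut-bound s 4≤ cut) (split-bound sp ss) ⟩
    budget c + ∑ budget cs
      ∎
    where
    open ≤-Reasoning
    open +-*-Solver

  ∑-charge-reoriented : ∀ {ps ps'} → Pointwise Reoriented ps ps' → All Simple ps →
                        ∑ charge ps' ≡ ∑ charge ps
  ∑-charge-reoriented []                        []       = refl
  ∑-charge-reoriented {p ∷ _} (inj₁ refl ∷ rs) (_ ∷ ss) = cong (_+_ (charge p)) (∑-charge-reoriented rs ss)
  ∑-charge-reoriented         (inj₂ refl ∷ rs) (s ∷ ss) =
    cong₂ _+_ (charge-reverse (AllPairs⇒Linked s)) (∑-charge-reoriented rs ss)

  joinAll-bound : ∀ qs → All (λ q → 4 ℕ.≤ length q) qs → Simple (concat qs) →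
                  N *ℚ W w (joinAll qs) ≤ ∑ charge qs
  joinAll-bound []       _        _ = ≤-reflexive (*-zeroʳ N)
  joinAll-bound (q ∷ qs) (4≤ ∷ _) s = begin
    N *ℚ (cycleW w (concat (q ∷ qs)) + 0ℚ) ≡⟨ cong (N *ℚ_) (+-identityʳ _) ⟩
    N *ℚ cycleW w (concat (q ∷ qs))        ≤⟨ cycleW≤charge s 2≤ ⟩
    charge (concat (q ∷ qs))               ≤⟨ charge-concat (q ∷ qs) s ⟩
    ∑ charge (q ∷ qs)                      ∎
    where
    open ≤-Reasoning
    2≤ : 2 ℕ.≤ length (q ++ concat qs)
    2≤ = ℕ.≤-trans (s≤s (s≤s z≤n)) (ℕ.≤-trans 4≤ (List.length-++-≤ˡ q))

  rejoin-↭ : ∀ {cs ts ps ps' qs} → Split w ys n cs ts ps → Pointwise Reoriented ps ps' → ps' ↭ qs →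
             concat ts ++ concat qs ↭ concat cs
  rejoin-↭ {ts = ts} split reoriented ps'↭qs = ↭-trans
    (++⁺ˡ (concat ts) (↭-trans (concat-↭ (↭-sym ps'↭qs)) (concat-reoriented reoriented))) (split-↭ split)

  rejoin-length : ∀ {cs ts ps ps' qs} → Split w ys n cs ts ps → Pointwise Reoriented ps ps' → ps' ↭ qs →
                  All (λ q → 4 ℕ.≤ length q) qs
  rejoin-length split reoriented ps'↭qs = All-resp-↭ ps'↭qs (reoriented-length reoriented (split-paths split))

  constructed-packing : ∀ {CX C} → Constructed w ys n CX C →
                        All (λ c → 3 ℕ.≤ length c) C × concat C ↭ concat CX
  constructed-packing (ts , ps , ps' , qs , split , reoriented , ps'↭qs , refl) =
    All.++⁺ (split-triangles split) (joinAll-length qs (rejoin-length split reoriented ps'↭qs)) ,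
    ↭-trans (↭-reflexive (trans (sym (List.concat-++ ts (joinAll qs))) (cong (concat ts ++_) (concat-joinAll qs))))
            (rejoin-↭ split reoriented ps'↭qs)

  constructed-bound : ∀ {CX C} → Constructed w ys n CX C → Simple (concat CX) →
                      N *ℚ W w C ≤ ½ *ℚ δset w ys (concat CX) + (+ 3 / 4) *ℚ (N *ℚ W w CX)
  constructed-bound {CX} (ts , ps , ps' , qs , split , reoriented , ps'↭qs , refl) s = begin
    N *ℚ W w (ts ++ joinAll qs)              ≡⟨ cong (N *ℚ_) (∑-++ (cycleW w) ts (joinAll qs)) ⟩
    N *ℚ (W w ts + W w (joinAll qs))         ≡⟨ *-distribˡ-+ N (W w ts) (W w (joinAll qs)) ⟩
    N *ℚ W w ts + N *ℚ W w (joinAll qs)      ≤⟨ +-monoʳ-≤ (N *ℚ W w ts) (joinAll-bound qs qs-long simple-qs) ⟩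
    N *ℚ W w ts + ∑ charge qs                ≡⟨ cong (_+_ (N *ℚ W w ts)) charges ⟩
    N *ℚ W w ts + ∑ charge ps                ≤⟨ split-bound split (AllPairs-concat⁻ CX s) ⟩
    ∑ budget CX                              ≡⟨ ∑-budget CX ⟩
    ½ *ℚ δset w ys (concat CX) + (+ 3 / 4) *ℚ (N *ℚ W w CX) ∎
    where
    open ≤-Reasoning
    qs-long = rejoin-length split reoriented ps'↭qs
    simple-qs : Simple (concat qs)
    simple-qs = proj₂ (AllPairs-++⁻ (concat ts) (Simple-↭ (↭-sym (rejoin-↭ split reoriented ps'↭qs)) s))
    simple-ps : All Simple ps
    simple-ps = AllPairs-concat⁻ ps (proj₂ (AllPairs-++⁻ (concat ts) (Simple-↭ (↭-sym (split-↭ split)) s)))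
    charges : ∑ charge qs ≡ ∑ charge ps
    charges = trans (∑-↭ charge (↭-sym ps'↭qs)) (∑-charge-reoriented reoriented simple-ps)

Distinct : {V : Set} → List V → V → V → Set
Distinct S u v = u ∈ S × v ∈ S × u ≢ v

module _ {V : Set} {S : List V} where

  Distinct-sym : ∀ {u v} → Distinct S u v → Distinct S v u
  Distinct-sym (u∈S , v∈S , u≢v) = v∈S , u∈S , u≢v ∘ sym

  Unique⇒AllPairs-Distinct : ∀ {xs} → Unique xs → xs ⊆ S → AllPairs (Distinct S) xs
  Unique⇒AllPairs-Distinct []       _    = []
  Unique⇒AllPairs-Distinct (x∉ ∷ u) xs⊆S =
    All.tabulate (λ v∈ → xs⊆S (here refl) , xs⊆S (there v∈) , All.lookup x∉ v∈) ∷
    Unique⇒AllPairs-Distinct u (xs⊆S ∘ there)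

module _ {V : Set} {X Y : List V} {w : V → V → ℚ} (bttp : BTTPWeight X Y w) where
  open BTTPWeight bttp

  weight-sym : ∀ {u v} → Distinct X u v → w u v ≡ w v u
  weight-sym (u∈X , v∈X , u≢v) = symmetric (∈-++⁺ˡ u∈X) (∈-++⁺ˡ v∈X) u≢v

  weight≤δ+δ : ∀ {Y'} → Y' ⊆ Y → ∀ {u v} → Distinct X u v →
               ℕtoℚ (length Y') *ℚ w u v ≤ δ w Y' u + δ w Y' v
  weight≤δ+δ {Y'} Y'⊆Y {u} {v} (u∈X , v∈X , u≢v) = begin
    ℕtoℚ (length Y') *ℚ w u v
      ≤⟨ ∑-≥ (λ y → w u y + w v y) (length Y') (nonneg u∈ v∈ u≢v) ℕ.≤-refl through ⟩
    ∑ (λ y → w u y + w v y) Y'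
      ≡⟨ ∑-+ (w u) (w v) Y' ⟩
    δ w Y' u + δ w Y' v
      ∎
    where
    open ≤-Reasoning
    u∈ = ∈-++⁺ˡ u∈X
    v∈ = ∈-++⁺ˡ v∈X
    through : ∀ {y} → y ∈ Y' → w u v ≤ w u y + w v y
    through {y} y∈Y' = begin
      w u v         ≤⟨ triangle u∈ y∈ v∈ u≢y (v≢y ∘ sym) u≢v ⟩
      w u y + w y v ≡⟨ cong (_+_ (w u y)) (symmetric y∈ v∈ (v≢y ∘ sym)) ⟩
      w u y + w v y ∎
      where
      y∈ = ∈-++⁺ʳ X (Y'⊆Y y∈Y')
      u≢y = Unique-++⇒Disjoint X leagues-distinct u∈X (Y'⊆Y y∈Y')
      v≢y = Unique-++⇒Disjoint X leagues-distinct v∈X (Y'⊆Y y∈Y')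

lemma3 : {V : Set} (X Y : List V) (w : V → V → ℚ) → BTTPWeight X Y w →
         (Xε Yε : List V) → Xε ⊆ X → Yε ⊆ Y → Unique Xε → Unique Yε →
         (n : ℕ) → length Xε ≡ n → length Yε ≡ n → (∃[ k ] n ≡ 3 * suc k) →
         (CX : List (List V)) → MinCyclePacking w Xε CX →
         (C : List (List V)) → Constructed w Yε n CX C →
         CyclePacking Xε C ×
         (ℕtoℚ n *ℚ W w C ≤ ½ *ℚ δset w Yε Xε + (+ 3 / 4) *ℚ (ℕtoℚ n *ℚ W w CX))
lemma3 X Y w bttp Xε Yε Xε⊆X Yε⊆Y Xε-unique _ n _ refl _ CX ((_ , CX↭Xε) , _) C constructed =
  (proj₁ packing , ↭-trans (proj₂ packing) CX↭Xε) , (begin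
    ℕtoℚ n *ℚ W w C
      ≤⟨ constructed-bound constructed simple ⟩
    ½ *ℚ δset w Yε (concat CX) + (+ 3 / 4) *ℚ (ℕtoℚ n *ℚ W w CX)
      ≡⟨ cong (λ d → ½ *ℚ d + (+ 3 / 4) *ℚ (ℕtoℚ n *ℚ W w CX)) (∑-↭ (δ w Yε) CX↭Xε) ⟩
    ½ *ℚ δset w Yε Xε + (+ 3 / 4) *ℚ (ℕtoℚ n *ℚ W w CX)
      ∎)
  where
  open ≤-Reasoning
  open Construction w Yε n (Distinct X) Distinct-sym (weight-sym bttp) (weight≤δ+δ bttp Yε⊆Y)
  packing = constructed-packing constructed
  simple : Simple (concat CX)
  simple = Simple-↭ (↭-sym CX↭Xε) (Unique⇒AllPairs-Distinct Xε-unique Xε⊆X)
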